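{- Let $p\in\mathbb{Z}$, let $(G_n)_{n\ge0}$ be defined by $G_0=0$, $G_1=1$ and $G_n=pG_{n-1}+G_{n-2}$ for $n\ge2$, let $r=p^2+4$, and let $s$ be a positive integer. If $p$ is odd and $s\mid r$, or $p$ is even and $s\mid r/4$, or $s\ge3$ is a prime with $s\mid r$, then for all integers $k,n\ge0$: $s^k\mid n$ if and only if $s^k\mid G_n$.
   Context: For integers $a,b$, $a\mid b$ means there is an integer $c$ with $b=ca$ (in particular $0\mid 0$). -}

module Defs where

open import Data.Nat using (ℕ; zero; suc)
open import Data.Integer using (ℤ; +_; _+_; _*_; _^_)
open import Data.Product using (∃)
open import Relation.Binary.PropositionalEquality using (_≡_)

G : ℤ → ℕ → ℤ
G p zero = + 0
G p (suc zero) = + 1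
G p (suc (suc n)) = p * G p (suc n) + G p n

r : ℤ → ℤ
r p = p ^ 2 + + 4

IntOdd : ℤ → Set
IntOdd p = ∃ λ m → p ≡ + 2 * m + + 1

IntEven : ℤ → Set
IntEven p = ∃ λ m → p ≡ + 2 * m

-- Let γ = c + √D in ℤ[√D] and write γⁿ = Xₙ + Yₙ√D. Then Yₙ₊₂ = 2c Yₙ₊₁ + (D − c²) Yₙ, so for
-- p = 2m, c = m, D = m² + 1 the Yₙ are exactly the Gₙ, and for c = p, D = p² + 4 they are 2ⁿ⁻¹ Gₙ.
-- Let q be a prime with q ∣ D, q ∤ c and q ≠ 3. The binomial expansion gives Yₙ ≡ n cⁿ⁻¹ (mod q);
-- applied to (Xₜ + Yₜ√D)^q it gives Y_{tq} = q Yₜ U with q ∤ U whenever q ∣ Yₜ, and q² ∤ Y_{tq}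
-- whenever q ∤ t. Induction on j then yields q^j ∣ n ⇔ q^j ∣ Yₙ (lifting the exponent).
-- Under each hypothesis every prime factor of s is such a prime (and odd when D = p² + 4, so the
-- factor 2ⁿ⁻¹ is harmless), and divisibility by s^k is decided prime power by prime power.

module Submission where

open import Defs
open import Data.Nat using (ℕ; _≥_)
open import Data.Nat.Primality using (Prime)
open import Data.Integer using (ℤ; +_; _^_)
open import Data.Integer.Divisibility using (_∣_)
open import Data.Integer.DivMod using (_/_)
open import Data.Sum using (_⊎_)
open import Data.Product using (_×_)
open import Function.Bundles using (_⇔_)

open import Data.Nat as ℕ using (zero; suc)
import Data.Nat.Properties as ℕ
open import Data.Nat.Divisibility as ℕ using (divides)
open import Data.Nat.Primality
  using (euclidsLemma; prime⇒irreducible; prime⇒nonZero; prime⇒nonTrivial; prime[2]; prime?)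
open import Data.Nat.Primality.Factorisation using (factorise; module PrimeFactorisation)
open import Data.Nat.ListAction using (product)
open import Data.List using (_∷_)
open import Data.List.Relation.Unary.All using (All; []; _∷_)
open import Data.Integer as ℤ using (_+_; _*_; _-_; ∣_∣)
import Data.Integer.Properties as ℤ
open import Data.Integer.DivMod using (_%_; a≡a%n+[a/n]*n; n%d<d)
open import Data.Integer.Divisibility.Signed as ℤ
  using (divides; ∣ᵤ⇒∣; ∣⇒∣ᵤ) renaming (_∣_ to _∣ˢ_)
open import Data.Integer.Tactic.RingSolver using (solve-∀)
open import Data.Empty using (⊥-elim)
open import Data.Sum using (inj₁; inj₂; [_,_]′)
import Data.Sum as Sum
open import Data.Product using (_,_; proj₁; proj₂; ∃; ∃₂)
open import Function.Bundles using (mk⇔; Equivalence)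
import Function.Properties.Equivalence as ⇔
open import Function.Base using (_∘_; id)
open import Relation.Nullary using (¬_; yes; no)
open import Relation.Nullary.Decidable using (from-yes; from-no)
open import Relation.Binary.PropositionalEquality
  using (_≡_; _≢_; refl; sym; trans; cong; cong₂; subst; subst₂; module ≡-Reasoning)

prime∤1 : ∀ {q} → Prime q → ¬ q ℕ.∣ 1
prime∤1 pq q∣1 = ℕ.nonTrivial⇒≢1 {{prime⇒nonTrivial pq}} (ℕ.∣1⇒≡1 q∣1)

prime∣prime⇒≡ : ∀ {q r} → Prime q → Prime r → q ℕ.∣ r → q ≡ r
prime∣prime⇒≡ pq pr q∣r =
  [ ⊥-elim ∘ ℕ.nonTrivial⇒≢1 {{prime⇒nonTrivial pq}} , id ]′ (prime⇒irreducible pr q∣r)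

prime[3] : Prime 3
prime[3] = from-yes (prime? 3)

prime∣^⇒∣ : ∀ {q} m n → Prime q → q ℕ.∣ m ℕ.^ n → q ℕ.∣ m
prime∣^⇒∣ m zero    pq q∣1 = ⊥-elim (prime∤1 pq q∣1)
prime∣^⇒∣ m (suc n) pq q∣mⁿ⁺¹ = [ id , prime∣^⇒∣ m n pq ]′ (euclidsLemma m (m ℕ.^ n) pq q∣mⁿ⁺¹)

prime^∣*⇒∣ : ∀ {q} m n j → Prime q → ¬ q ℕ.∣ m → q ℕ.^ j ℕ.∣ m ℕ.* n → q ℕ.^ j ℕ.∣ n
prime^∣*⇒∣ m n zero pq q∤m _ = ℕ.1∣ n
prime^∣*⇒∣ {q} m n (suc j) pq q∤m qʲ⁺¹∣mn
  with euclidsLemma m n pq (ℕ.∣-trans (ℕ.m∣m*n (q ℕ.^ j)) qʲ⁺¹∣mn)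
... | inj₁ q∣m = ⊥-elim (q∤m q∣m)
... | inj₂ (divides n′ refl) =
  subst (q ℕ.* q ℕ.^ j ℕ.∣_) (ℕ.*-comm q n′) (ℕ.*-monoʳ-∣ q (prime^∣*⇒∣ m n′ j pq q∤m qʲ∣mn′))
  where
  instance _ = prime⇒nonZero pq
  m[n′q]≡q[mn′] : m ℕ.* (n′ ℕ.* q) ≡ q ℕ.* (m ℕ.* n′)
  m[n′q]≡q[mn′] = trans (sym (ℕ.*-assoc m n′ q)) (ℕ.*-comm (m ℕ.* n′) q)
  qʲ∣mn′ : q ℕ.^ j ℕ.∣ m ℕ.* n′
  qʲ∣mn′ = ℕ.*-cancelˡ-∣ q (subst (q ℕ.* q ℕ.^ j ℕ.∣_) m[n′q]≡q[mn′] qʲ⁺¹∣mn)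

product∣-byPrimePowers : ∀ {ps} → All Prime ps → ∀ n →
  (∀ {q} j → Prime q → q ℕ.^ j ℕ.∣ product ps → q ℕ.^ j ℕ.∣ n) → product ps ℕ.∣ n
product∣-byPrimePowers [] n _ = ℕ.1∣ n
product∣-byPrimePowers {q ∷ ps} (pq ∷ pps) n local
  with ℕ.m*n∣⇒m∣ q 1 (local 1 pq (ℕ.*-monoʳ-∣ q (ℕ.1∣ product ps)))
... | divides n′ refl =
  subst (q ℕ.* product ps ℕ.∣_) (ℕ.*-comm q n′) (ℕ.*-monoʳ-∣ q (product∣-byPrimePowers pps n′ local′))
  where
  instance _ = prime⇒nonZero pq
  local′ : ∀ {r} j → Prime r → r ℕ.^ j ℕ.∣ product ps → r ℕ.^ j ℕ.∣ n′
  local′ {r} j pr rʲ∣ps with r ℕ.≟ q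
  ... | yes refl = ℕ.*-cancelˡ-∣ q
    (subst (q ℕ.* q ℕ.^ j ℕ.∣_) (ℕ.*-comm n′ q) (local (suc j) pq (ℕ.*-monoʳ-∣ q rʲ∣ps)))
  ... | no r≢q = prime^∣*⇒∣ q n′ j pr (r≢q ∘ prime∣prime⇒≡ pr pq)
    (subst (r ℕ.^ j ℕ.∣_) (ℕ.*-comm n′ q) (local j pr (ℕ.∣n⇒∣m*n q rʲ∣ps)))

∣-byPrimePowers : ∀ {m} n .{{_ : ℕ.NonZero m}} →
  (∀ {q} j → Prime q → q ℕ.^ j ℕ.∣ m → q ℕ.^ j ℕ.∣ n) → m ℕ.∣ n
∣-byPrimePowers {m} n local =
  subst (ℕ._∣ n) (sym isFactorisation)
    (product∣-byPrimePowers factorsPrime n (λ j pq → local j pq ∘ subst (_ ℕ.∣_) (sym isFactorisation)))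
  where open PrimeFactorisation (factorise m)

^∣-transfer : ∀ {s} k {m n} .{{_ : ℕ.NonZero s}} →
  (∀ {q} j → Prime q → q ℕ.∣ s → q ℕ.^ j ℕ.∣ m → q ℕ.^ j ℕ.∣ n) → s ℕ.^ k ℕ.∣ m → s ℕ.^ k ℕ.∣ n
^∣-transfer {s} k {n = n} transfer sᵏ∣m = ∣-byPrimePowers n {{ℕ.m^n≢0 s k}} local
  where
  local : ∀ {q} j → Prime q → q ℕ.^ j ℕ.∣ s ℕ.^ k → q ℕ.^ j ℕ.∣ n
  local zero    _  _       = ℕ.1∣ n
  local {q} (suc j) pq qʲ⁺¹∣sᵏ =
    transfer (suc j) pq (prime∣^⇒∣ s k pq (ℕ.∣-trans (ℕ.m∣m*n (q ℕ.^ j)) qʲ⁺¹∣sᵏ))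
      (ℕ.∣-trans qʲ⁺¹∣sᵏ sᵏ∣m)

∣i^n∣≡∣i∣^n : ∀ i n → ∣ i ^ n ∣ ≡ ∣ i ∣ ℕ.^ n
∣i^n∣≡∣i∣^n i zero    = refl
∣i^n∣≡∣i∣^n i (suc n) = trans (ℤ.abs-* i (i ^ n)) (cong (∣ i ∣ ℕ.*_) (∣i^n∣≡∣i∣^n i n))

+q^j∣ˢi⇔q^j∣∣i∣ : ∀ q j i → (+ q) ^ j ∣ˢ i ⇔ q ℕ.^ j ℕ.∣ ∣ i ∣
+q^j∣ˢi⇔q^j∣∣i∣ q j i = mk⇔
  (λ h → subst (ℕ._∣ ∣ i ∣) (∣i^n∣≡∣i∣^n (+ q) j) (∣⇒∣ᵤ h))
  (λ h → ∣ᵤ⇒∣ (subst (ℕ._∣ ∣ i ∣) (sym (∣i^n∣≡∣i∣^n (+ q) j)) h))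

euclidsLemma-ℤ : ∀ i j {q} → Prime q → + q ∣ˢ i * j → + q ∣ˢ i ⊎ + q ∣ˢ j
euclidsLemma-ℤ i j pq q∣ij =
  Sum.map ∣ᵤ⇒∣ ∣ᵤ⇒∣ (euclidsLemma ∣ i ∣ ∣ j ∣ pq (subst (_ ℕ.∣_) (ℤ.abs-* i j) (∣⇒∣ᵤ q∣ij)))

prime∣^⇒∣-ℤ : ∀ i n {q} → Prime q → + q ∣ˢ i ^ n → + q ∣ˢ i
prime∣^⇒∣-ℤ i n pq q∣iⁿ =
  ∣ᵤ⇒∣ (prime∣^⇒∣ ∣ i ∣ n pq (subst (_ ℕ.∣_) (∣i^n∣≡∣i∣^n i n) (∣⇒∣ᵤ q∣iⁿ)))

prime^∣*⇒∣-ℤ : ∀ i j k {q} → Prime q → ¬ + q ∣ˢ i → (+ q) ^ k ∣ˢ i * j → (+ q) ^ k ∣ˢ j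
prime^∣*⇒∣-ℤ i j k {q} pq q∤i qᵏ∣ij = Equivalence.from (+q^j∣ˢi⇔q^j∣∣i∣ q k j)
  (prime^∣*⇒∣ ∣ i ∣ ∣ j ∣ k pq (q∤i ∘ ∣ᵤ⇒∣)
    (subst (_ ℕ.∣_) (ℤ.abs-* i j) (Equivalence.to (+q^j∣ˢi⇔q^j∣∣i∣ q k (i * j)) qᵏ∣ij)))

prime∤*-ℤ : ∀ i j {q} → Prime q → ¬ + q ∣ˢ i → ¬ + q ∣ˢ j → ¬ + q ∣ˢ i * j
prime∤*-ℤ i j pq q∤i q∤j = [ q∤i , q∤j ]′ ∘ euclidsLemma-ℤ i j pq

i*j/j≡i : ∀ i j .{{_ : ℤ.NonZero j}} → i * j / j ≡ i
i*j/j≡i i j = sym (ℤ.i-j≡0⇒i≡j i w (ℤ.∣i∣≡0⇒i≡0 (ℕ.n<1⇒n≡0 ∣i-w∣<1)))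
  where
  w = i * j / j
  ρ = (i * j) % j
  shift : ∀ i j w ρ → i * j ≡ ρ + w * j → (i - w) * j ≡ ρ
  shift i j w ρ eq = trans (distrib i j w) (trans (cong (_- w * j) eq) (cancel ρ (w * j)))
    where
    distrib : ∀ i j w → (i - w) * j ≡ i * j - w * j
    distrib = solve-∀
    cancel : ∀ a b → a + b - b ≡ a
    cancel = solve-∀
  ∣i-w∣*∣j∣≡ρ : ∣ i - w ∣ ℕ.* ∣ j ∣ ≡ ρ
  ∣i-w∣*∣j∣≡ρ = trans (sym (ℤ.abs-* (i - w) j)) (cong ∣_∣ (shift i j w (+ ρ) (a≡a%n+[a/n]*n (i * j) j)))
  ∣i-w∣<1 : ∣ i - w ∣ ℕ.< 1
  ∣i-w∣<1 = ℕ.*-cancelʳ-< ∣ j ∣ ∣ i - w ∣ 1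
    (subst₂ ℕ._<_ (sym ∣i-w∣*∣j∣≡ρ) (sym (ℕ.*-identityˡ ∣ j ∣)) (n%d<d (i * j) j))

3∤x²+1 : ∀ x → ¬ + 3 ∣ˢ x * x + + 1
3∤x²+1 x 3∣x²+1 = 3∤ρ²+1 ρ (n%d<d x (+ 3)) (ℤ.∣m+n∣n⇒∣m 3∣ρ²+1+3l (divides l refl))
  where
  ρ = x % + 3
  k = x / + 3
  expand : ∀ ρ k → (ρ + k * + 3) * (ρ + k * + 3) + + 1 ≡ (ρ * ρ + + 1) + k * (+ 2 * ρ + k * + 3) * + 3
  expand = solve-∀
  l = k * (+ 2 * + ρ + k * + 3)
  3∣ρ²+1+3l : + 3 ∣ˢ + ρ * + ρ + + 1 + l * + 3
  3∣ρ²+1+3l = subst (+ 3 ∣ˢ_) (expand (+ ρ) k)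
    (subst (λ x → + 3 ∣ˢ x * x + + 1) (a≡a%n+[a/n]*n x (+ 3)) 3∣x²+1)
  3∤ρ²+1 : ∀ ρ → ρ ℕ.< 3 → ¬ + 3 ∣ˢ + ρ * + ρ + + 1
  3∤ρ²+1 0 _ = from-no (3 ℕ.∣? 1) ∘ ∣⇒∣ᵤ
  3∤ρ²+1 1 _ = from-no (3 ℕ.∣? 2) ∘ ∣⇒∣ᵤ
  3∤ρ²+1 2 _ = from-no (3 ℕ.∣? 5) ∘ ∣⇒∣ᵤ
  3∤ρ²+1 (suc (suc (suc _))) (ℕ.s≤s (ℕ.s≤s (ℕ.s≤s ())))

module QuadraticIntegers (D : ℤ) where

  -- (a , b) stands for a + b√D.

  infixl 7 _·_
  _·_ : ℤ × ℤ → ℤ × ℤ → ℤ × ℤ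
  (a , b) · (c , d) = a * c + D * (b * d) , a * d + b * c

  pow : ℤ × ℤ → ℕ → ℤ × ℤ
  pow z zero    = + 1 , + 0
  pow z (suc n) = pow z n · z

  ·-identityˡ : ∀ z → (+ 1 , + 0) · z ≡ z
  ·-identityˡ (a , b) = cong₂ _,_ (re a b D) (im a b)
    where
    re : ∀ a b D → + 1 * a + D * (+ 0 * b) ≡ a
    re = solve-∀
    im : ∀ a b → + 1 * b + + 0 * a ≡ b
    im = solve-∀

  ·-comm : ∀ x y → x · y ≡ y · x
  ·-comm (a , b) (c , d) = cong₂ _,_ (re a b c d D) (im a b c d)
    where
    re : ∀ a b c d D → a * c + D * (b * d) ≡ c * a + D * (d * b)
    re = solve-∀
    im : ∀ a b c d → a * d + b * c ≡ c * b + d * a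
    im = solve-∀

  ·-assoc : ∀ x y z → x · y · z ≡ x · (y · z)
  ·-assoc (a , b) (c , d) (e , f) = cong₂ _,_ (re a b c d e f D) (im a b c d e f D)
    where
    re : ∀ a b c d e f D → (a * c + D * (b * d)) * e + D * ((a * d + b * c) * f)
                         ≡ a * (c * e + D * (d * f)) + D * (b * (c * f + d * e))
    re = solve-∀
    im : ∀ a b c d e f D → (a * c + D * (b * d)) * f + (a * d + b * c) * e
                         ≡ a * (c * f + d * e) + b * (c * e + D * (d * f))
    im = solve-∀

  pow-+ : ∀ z m n → pow z (m ℕ.+ n) ≡ pow z m · pow z n
  pow-+ z zero    n = sym (·-identityˡ (pow z n))
  pow-+ z (suc m) n = begin
    pow z (m ℕ.+ n) · z      ≡⟨ cong (_· z) (pow-+ z m n) ⟩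
    pow z m · pow z n · z    ≡⟨ ·-assoc (pow z m) (pow z n) z ⟩
    pow z m · (pow z n · z)  ≡⟨ cong (pow z m ·_) (·-comm (pow z n) z) ⟩
    pow z m · (z · pow z n)  ≡⟨ ·-assoc (pow z m) z (pow z n) ⟨
    pow z m · z · pow z n    ∎
    where open ≡-Reasoning

  pow-* : ∀ z m n → pow z (m ℕ.* n) ≡ pow (pow z m) n
  pow-* z m zero    = cong (pow z) (ℕ.*-zeroʳ m)
  pow-* z m (suc n) = begin
    pow z (m ℕ.* suc n)           ≡⟨ cong (pow z) (ℕ.*-suc m n) ⟩
    pow z (m ℕ.+ m ℕ.* n)         ≡⟨ pow-+ z m (m ℕ.* n) ⟩
    pow z m · pow z (m ℕ.* n)     ≡⟨ cong (pow z m ·_) (pow-* z m n) ⟩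
    pow z m · pow (pow z m) n     ≡⟨ ·-comm (pow z m) (pow (pow z m) n) ⟩
    pow (pow z m) n · pow z m     ∎
    where open ≡-Reasoning

  pow-expansion : ∀ a b e → ∃₂ λ L K →
    proj₁ (pow (a , b) (suc e)) ≡ a ^ suc e + D * (b * b) * L ×
    proj₂ (pow (a , b) (suc e)) ≡ + suc e * a ^ e * b + D * (b * (b * b)) * K
  pow-expansion a b zero = + 0 , + 0 , re a b D , im a b D
    where
    re : ∀ a b D → + 1 * a + D * (+ 0 * b) ≡ a * + 1 + D * (b * b) * + 0
    re = solve-∀
    im : ∀ a b D → + 1 * b + + 0 * a ≡ + 1 * + 1 * b + D * (b * (b * b)) * + 0
    im = solve-∀
  pow-expansion a b (suc e) with pow-expansion a b e
  ... | L , K , eqˣ , eqʸ =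
    L * a + + suc e * a ^ e + D * (b * b) * K , L + K * a ,
    trans (cong₂ (λ x y → x * a + D * (y * b)) eqˣ eqʸ) (re a b D L K (a ^ e) (+ suc e)) ,
    trans (cong₂ (λ x y → x * b + y * a) eqˣ eqʸ) (im a b D L K (a ^ e) (+ suc e))
    where
    re : ∀ a b D L K P E → (a * P + D * (b * b) * L) * a + D * ((E * P * b + D * (b * (b * b)) * K) * b)
                         ≡ a * (a * P) + D * (b * b) * (L * a + E * P + D * (b * b) * K)
    re = solve-∀
    im : ∀ a b D L K P E → (a * P + D * (b * b) * L) * b + (E * P * b + D * (b * (b * b)) * K) * a
                         ≡ (+ 1 + E) * (a * P) * b + D * (b * (b * b)) * (L + K * a)
    im = solve-∀

module PowersOfγ (c D : ℤ) where
  open QuadraticIntegers D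

  γ : ℤ × ℤ
  γ = c , + 1

  X Y : ℕ → ℤ
  X n = proj₁ (pow γ n)
  Y n = proj₂ (pow γ n)

  Y-recurrence : ∀ n → Y (suc (suc n)) ≡ + 2 * c * Y (suc n) + (D - c * c) * Y n
  Y-recurrence n = step (X n) (Y n) c D
    where
    step : ∀ x y c D → (x * c + D * (y * + 1)) * + 1 + (x * + 1 + y * c) * c
                     ≡ + 2 * c * (x * + 1 + y * c) + (D - c * c) * y
    step = solve-∀

  γ-expansion : ∀ m → ∃₂ λ L K → X (suc m) ≡ c ^ suc m + D * L × Y (suc m) ≡ + suc m * c ^ m + D * K
  γ-expansion m with pow-expansion c (+ 1) m
  ... | L , K , eqˣ , eqʸ = L , K , trans eqˣ (re (c ^ suc m) D L) , trans eqʸ (im (+ suc m * c ^ m) D K)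
    where
    re : ∀ P D L → P + D * (+ 1 * + 1) * L ≡ P + D * L
    re = solve-∀
    im : ∀ P D K → P * + 1 + D * (+ 1 * (+ 1 * + 1)) * K ≡ P + D * K
    im = solve-∀

  -- The factor 6c³ makes the binomial coefficients C(m,2), C(m,3) and the powers c^(m-1), c^(m-3) integral.
  γ-thirdOrderExpansion : ∀ m → ∃₂ λ F E →
    + 6 * (c * (c * c)) * X m ≡ + 6 * (c ^ m * (c * (c * c))) + + 3 * + m * (+ m - + 1) * (c ^ m * c) * D + D * D * F ×
    + 6 * (c * (c * c)) * Y m ≡ + 6 * + m * (c ^ m * (c * c)) + + m * (+ m - + 1) * (+ m - + 2) * c ^ m * D + D * D * E
  γ-thirdOrderExpansion zero = + 0 , + 0 , re₀ c D , im₀ c D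
    where
    re₀ : ∀ c D → + 6 * (c * (c * c)) * + 1
                ≡ + 6 * (+ 1 * (c * (c * c))) + + 3 * + 0 * (+ 0 - + 1) * (+ 1 * c) * D + D * D * + 0
    re₀ = solve-∀
    im₀ : ∀ c D → + 6 * (c * (c * c)) * + 0
                ≡ + 6 * + 0 * (+ 1 * (c * c)) + + 0 * (+ 0 - + 1) * (+ 0 - + 2) * + 1 * D + D * D * + 0
    im₀ = solve-∀
  γ-thirdOrderExpansion (suc m) with γ-thirdOrderExpansion m
  ... | F , E , eqˣ , eqʸ =
    c * F + + m * (+ m - + 1) * (+ m - + 2) * c ^ m + D * E , F + c * E ,
    trans (splitˣ c D (X m) (Y m)) (trans (cong₂ (λ u v → c * u + D * v) eqˣ eqʸ) (re c D (c ^ m) (+ m) F E)) ,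
    trans (splitʸ c D (X m) (Y m)) (trans (cong₂ (λ u v → u + c * v) eqˣ eqʸ) (im c D (c ^ m) (+ m) F E))
    where
    splitˣ : ∀ c D x y → + 6 * (c * (c * c)) * (x * c + D * (y * + 1))
                       ≡ c * (+ 6 * (c * (c * c)) * x) + D * (+ 6 * (c * (c * c)) * y)
    splitˣ = solve-∀
    splitʸ : ∀ c D x y → + 6 * (c * (c * c)) * (x * + 1 + y * c)
                       ≡ + 6 * (c * (c * c)) * x + c * (+ 6 * (c * (c * c)) * y)
    splitʸ = solve-∀
    re : ∀ c D P M F E →
         c * (+ 6 * (P * (c * (c * c))) + + 3 * M * (M - + 1) * (P * c) * D + D * D * F)
           + D * (+ 6 * M * (P * (c * c)) + M * (M - + 1) * (M - + 2) * P * D + D * D * E)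
         ≡ + 6 * ((c * P) * (c * (c * c))) + + 3 * (+ 1 + M) * ((+ 1 + M) - + 1) * ((c * P) * c) * D
           + D * D * (c * F + M * (M - + 1) * (M - + 2) * P + D * E)
    re = solve-∀
    im : ∀ c D P M F E →
         (+ 6 * (P * (c * (c * c))) + + 3 * M * (M - + 1) * (P * c) * D + D * D * F)
           + c * (+ 6 * M * (P * (c * c)) + M * (M - + 1) * (M - + 2) * P * D + D * D * E)
         ≡ + 6 * (+ 1 + M) * ((c * P) * (c * c)) + (+ 1 + M) * ((+ 1 + M) - + 1) * ((+ 1 + M) - + 2) * (c * P) * D
           + D * D * (F + c * E)
    im = solve-∀

module LiftingTheExponent (c D : ℤ) {q : ℕ} (pq : Prime q)
                          (q∣D : + q ∣ˢ D) (q∤c : ¬ + q ∣ˢ c) (q≢3 : q ≢ 3) where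
  open QuadraticIntegers D
  open PowersOfγ c D
  open ℤ._∣_ q∣D renaming (quotient to D′; equality to D≡D′*q)

  instance _ = prime⇒nonZero pq

  q²≡q*q : (+ q) ^ 2 ≡ + q * + q
  q²≡q*q = cong (+ q *_) (ℤ.*-identityʳ (+ q))

  q∤cᵉ : ∀ e → ¬ + q ∣ˢ c ^ e
  q∤cᵉ e = q∤c ∘ prime∣^⇒∣-ℤ c e pq

  q∤X : ∀ n → ¬ + q ∣ˢ X n
  q∤X zero q∣1 = prime∤1 pq (∣⇒∣ᵤ q∣1)
  q∤X (suc m) q∣X with γ-expansion m
  ... | L , _ , eqˣ , _ =
    q∤cᵉ (suc m) (ℤ.∣m+n∣n⇒∣m (subst (+ q ∣ˢ_) eqˣ q∣X) (ℤ.∣m⇒∣m*n L q∣D))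

  q∣Y⇒q∣n : ∀ n → + q ∣ˢ Y n → q ℕ.∣ n
  q∣Y⇒q∣n zero    _   = q ℕ.∣0
  q∣Y⇒q∣n (suc m) q∣Y with γ-expansion m
  ... | _ , K , _ , eqʸ =
    [ ∣⇒∣ᵤ , ⊥-elim ∘ q∤cᵉ m ]′
      (euclidsLemma-ℤ (+ suc m) (c ^ m) pq (ℤ.∣m+n∣n⇒∣m (subst (+ q ∣ˢ_) eqʸ q∣Y) (ℤ.∣m⇒∣m*n K q∣D)))

  Y[t*q]≡q*Y[t]*U : ∀ t → ∃ λ U → Y (t ℕ.* q) ≡ + q * (Y t * U) × (+ q ∣ˢ Y t → ¬ + q ∣ˢ U)
  Y[t*q]≡q*Y[t]*U t with pow-expansion (X t) (Y t) (ℕ.pred q)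
  ... | _ , K , _ , eqʸ = U , Y[tq]≡ , q∤U
    where
    e = ℕ.pred q
    U = X t ^ e + D′ * (Y t * Y t) * K
    factor : ∀ x y D′ K Q → Q * x * y + D′ * Q * (y * (y * y)) * K ≡ Q * (y * (x + D′ * (y * y) * K))
    factor = solve-∀
    Y[tq]≡ : Y (t ℕ.* q) ≡ + q * (Y t * U)
    Y[tq]≡ = begin
      Y (t ℕ.* q)                                               ≡⟨ cong proj₂ (pow-* γ t q) ⟩
      proj₂ (pow (X t , Y t) q)                                 ≡⟨ cong (proj₂ ∘ pow (X t , Y t)) (sym q≡1+e) ⟩
      proj₂ (pow (X t , Y t) (suc e))                           ≡⟨ eqʸ ⟩
      + suc e * X t ^ e * Y t + D * (Y t * (Y t * Y t)) * K     ≡⟨ cong₂ (λ Q D → Q * X t ^ e * Y t + D * (Y t * (Y t * Y t)) * K)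
                                                                     (cong +_ q≡1+e) D≡D′*q ⟩
      + q * X t ^ e * Y t + D′ * + q * (Y t * (Y t * Y t)) * K  ≡⟨ factor (X t ^ e) (Y t) D′ K (+ q) ⟩
      + q * (Y t * U)                                           ∎
      where
      open ≡-Reasoning
      q≡1+e = ℕ.suc-pred q
    q∤U : + q ∣ˢ Y t → ¬ + q ∣ˢ U
    q∤U q∣Y q∣U = q∤X t (prime∣^⇒∣-ℤ (X t) e pq
      (ℤ.∣m+n∣n⇒∣m q∣U (ℤ.∣m⇒∣m*n K (ℤ.∣n⇒∣m*n D′ (ℤ.∣m⇒∣m*n (Y t) q∣Y)))))

  q^j∣n⇒q^j∣Y : ∀ j {n} → q ℕ.^ j ℕ.∣ n → (+ q) ^ j ∣ˢ Y n
  q^j∣n⇒q^j∣Y zero    _ = ∣ᵤ⇒∣ (ℕ.1∣ _)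
  q^j∣n⇒q^j∣Y (suc j) qʲ⁺¹∣n with ℕ.m*n∣⇒m∣ q (q ℕ.^ j) qʲ⁺¹∣n
  ... | divides t refl with Y[t*q]≡q*Y[t]*U t
  ... | U , Y[tq]≡ , _ =
    subst ((+ q) ^ suc j ∣ˢ_) (sym Y[tq]≡) (ℤ.*-monoʳ-∣ (+ q) (ℤ.∣m⇒∣m*n U (q^j∣n⇒q^j∣Y j qʲ∣t)))
    where
    qʲ∣t : q ℕ.^ j ℕ.∣ t
    qʲ∣t = ℕ.*-cancelˡ-∣ q (subst (q ℕ.* q ℕ.^ j ℕ.∣_) (ℕ.*-comm t q) qʲ⁺¹∣n)

  q∣n⇒q∣Y : ∀ {n} → q ℕ.∣ n → + q ∣ˢ Y n
  q∣n⇒q∣Y q∣n =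
    subst (_∣ˢ _) (ℤ.^-identityʳ (+ q)) (q^j∣n⇒q^j∣Y 1 (subst (ℕ._∣ _) (sym (ℕ.^-identityʳ q)) q∣n))

  -- Modulo q², 6c³ Y_q ≡ 6q c^(q+2) because q divides both D and C(q,3) = q(q−1)(q−2)/6;
  -- this is where q ∤ 6 is needed. For q = 2 one computes Y₂ = 2c directly.
  q²∤Y[q] : ¬ (+ q) ^ 2 ∣ˢ Y q
  q²∤Y[q] with q ℕ.≟ 2
  ... | yes refl = λ 4∣Y₂ → q∤c (ℤ.*-cancelˡ-∣ (+ 2) (subst (+ 4 ∣ˢ_) (Y₂≡2c c D) 4∣Y₂))
    where
    Y₂≡2c : ∀ c D → (+ 1 * c + D * (+ 0 * + 1)) * + 1 + (+ 1 * + 1 + + 0 * c) * c ≡ + 2 * c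
    Y₂≡2c = solve-∀
  ... | no q≢2 with γ-thirdOrderExpansion q
  ... | _ , E , _ , eqʸ = q∤Z ∘ q∣Z
    where
    Z = + 6 * (c ^ q * (c * c))
    W = (+ q - + 1) * (+ q - + 2) * c ^ q * D′ + D′ * D′ * E
    split : ∀ Q P c D′ E → + 6 * Q * (P * (c * c)) + Q * (Q - + 1) * (Q - + 2) * P * (D′ * Q) + D′ * Q * (D′ * Q) * E
                         ≡ Q * (+ 6 * (P * (c * c))) + Q * Q * ((Q - + 1) * (Q - + 2) * P * D′ + D′ * D′ * E)
    split = solve-∀
    6c³Y[q]≡ : + 6 * (c * (c * c)) * Y q ≡ + q * Z + + q * + q * W
    6c³Y[q]≡ = begin
      + 6 * (c * (c * c)) * Y q
        ≡⟨ eqʸ ⟩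
      + 6 * + q * (c ^ q * (c * c)) + + q * (+ q - + 1) * (+ q - + 2) * c ^ q * D + D * D * E
        ≡⟨ cong (λ D → + 6 * + q * (c ^ q * (c * c)) + + q * (+ q - + 1) * (+ q - + 2) * c ^ q * D + D * D * E) D≡D′*q ⟩
      + 6 * + q * (c ^ q * (c * c)) + + q * (+ q - + 1) * (+ q - + 2) * c ^ q * (D′ * + q) + D′ * + q * (D′ * + q) * E
        ≡⟨ split (+ q) (c ^ q) c D′ E ⟩
      + q * Z + + q * + q * W
        ∎
      where open ≡-Reasoning
    q∣Z : (+ q) ^ 2 ∣ˢ Y q → + q ∣ˢ Z
    q∣Z q²∣Y = ℤ.*-cancelˡ-∣ (+ q) (ℤ.∣m+n∣n⇒∣m q²∣qZ+q²W (ℤ.∣m⇒∣m*n W ℤ.∣-refl))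
      where
      q²∣qZ+q²W : + q * + q ∣ˢ + q * Z + + q * + q * W
      q²∣qZ+q²W = subst (+ q * + q ∣ˢ_) 6c³Y[q]≡
        (ℤ.∣n⇒∣m*n (+ 6 * (c * (c * c))) (subst (_∣ˢ Y q) q²≡q*q q²∣Y))
    q∤6 : ¬ + q ∣ˢ + 6
    q∤6 q∣6 = [ q≢2 ∘ prime∣prime⇒≡ pq prime[2] , q≢3 ∘ prime∣prime⇒≡ pq prime[3] ]′
                (euclidsLemma 2 3 pq (∣⇒∣ᵤ q∣6))
    q∤Z : ¬ + q ∣ˢ Z
    q∤Z = prime∤*-ℤ (+ 6) _ pq q∤6 (prime∤*-ℤ (c ^ q) _ pq (q∤cᵉ q) (prime∤*-ℤ c c pq q∤c q∤c))

  q∤t⇒q²∤Y[t*q] : ∀ t → ¬ q ℕ.∣ t → ¬ (+ q) ^ 2 ∣ˢ Y (t ℕ.* q)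
  q∤t⇒q²∤Y[t*q] zero    q∤0 _ = q∤0 (q ℕ.∣0)
  q∤t⇒q²∤Y[t*q] (suc e) q∤t q²∣Y
    with pow-expansion (X q) (Y q) e | q∣n⇒q∣Y (ℕ.∣-refl {q})
  ... | _ , K , _ , eqʸ | divides w Y[q]≡w*q =
    q²∤Y[q] (prime^∣*⇒∣-ℤ T (Y q) 2 pq q∤T (ℤ.∣m+n∣n⇒∣m (subst ((+ q) ^ 2 ∣ˢ_) Y[tq]≡ q²∣Y) q²∣rest))
    where
    T = + suc e * X q ^ e
    Y[tq]≡ : Y (suc e ℕ.* q) ≡ T * Y q + D * (Y q * (Y q * Y q)) * K
    Y[tq]≡ = trans (cong Y (ℕ.*-comm (suc e) q)) (trans (cong proj₂ (pow-* γ q (suc e))) eqʸ)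
    regroup : ∀ D′ w y K Q → D′ * Q * (w * Q * (y * y)) * K ≡ D′ * w * (y * y) * K * (Q * Q)
    regroup = solve-∀
    q²∣rest : (+ q) ^ 2 ∣ˢ D * (Y q * (Y q * Y q)) * K
    q²∣rest = divides (D′ * w * (Y q * Y q) * K) (begin
      D * (Y q * (Y q * Y q)) * K               ≡⟨ cong₂ (λ D y → D * (y * (Y q * Y q)) * K) D≡D′*q Y[q]≡w*q ⟩
      D′ * + q * (w * + q * (Y q * Y q)) * K    ≡⟨ regroup D′ w (Y q) K (+ q) ⟩
      D′ * w * (Y q * Y q) * K * (+ q * + q)    ≡⟨ cong (D′ * w * (Y q * Y q) * K *_) q²≡q*q ⟨
      D′ * w * (Y q * Y q) * K * (+ q) ^ 2      ∎)
      where open ≡-Reasoning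
    q∤T : ¬ + q ∣ˢ T
    q∤T = prime∤*-ℤ (+ suc e) (X q ^ e) pq (q∤t ∘ ∣⇒∣ᵤ) (q∤X q ∘ prime∣^⇒∣-ℤ (X q) e pq)

  q^j⁺²∣Y⇒q^j⁺²∣n : ∀ j → (∀ t → (+ q) ^ suc j ∣ˢ Y t → q ℕ.^ suc j ℕ.∣ t) →
                     ∀ n → (+ q) ^ suc (suc j) ∣ˢ Y n → q ℕ.^ suc (suc j) ℕ.∣ n
  q^j⁺²∣Y⇒q^j⁺²∣n j ih n qʲ⁺²∣Y
    with q∣Y⇒q∣n n (ℤ.∣-trans (ℤ.∣m⇒∣m*n ((+ q) ^ suc j) ℤ.∣-refl) qʲ⁺²∣Y)
  ... | divides t refl with q ℕ.∣? t | Y[t*q]≡q*Y[t]*U t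
  ... | no  q∤t | _ = ⊥-elim (q∤t⇒q²∤Y[t*q] t q∤t (ℤ.∣-trans q²∣qʲ⁺² qʲ⁺²∣Y))
    where
    q²∣qʲ⁺² : (+ q) ^ 2 ∣ˢ (+ q) ^ suc (suc j)
    q²∣qʲ⁺² = ℤ.*-monoʳ-∣ (+ q) (ℤ.*-monoʳ-∣ (+ q) (∣ᵤ⇒∣ (ℕ.1∣ _)))
  ... | yes q∣t | U , Y[tq]≡ , q∤U =
    subst (q ℕ.* q ℕ.^ suc j ℕ.∣_) (ℕ.*-comm q t) (ℕ.*-monoʳ-∣ q (ih t qʲ⁺¹∣Y[t]))
    where
    qʲ⁺¹∣Y[t] : (+ q) ^ suc j ∣ˢ Y t
    qʲ⁺¹∣Y[t] = prime^∣*⇒∣-ℤ U (Y t) (suc j) pq (q∤U (q∣n⇒q∣Y q∣t))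
      (subst ((+ q) ^ suc j ∣ˢ_) (ℤ.*-comm (Y t) U)
        (ℤ.*-cancelˡ-∣ (+ q) (subst ((+ q) ^ suc (suc j) ∣ˢ_) Y[tq]≡ qʲ⁺²∣Y)))

  q^j∣Y⇒q^j∣n : ∀ j n → (+ q) ^ j ∣ˢ Y n → q ℕ.^ j ℕ.∣ n
  q^j∣Y⇒q^j∣n zero          n _   = ℕ.1∣ n
  q^j∣Y⇒q^j∣n (suc zero)    n q∣Y =
    subst (ℕ._∣ n) (sym (ℕ.^-identityʳ q)) (q∣Y⇒q∣n n (subst (_∣ˢ Y n) (ℤ.^-identityʳ (+ q)) q∣Y))
  q^j∣Y⇒q^j∣n (suc (suc j)) = q^j⁺²∣Y⇒q^j⁺²∣n j (q^j∣Y⇒q^j∣n (suc j))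

  q^j∣n⇔q^j∣Y : ∀ j n → q ℕ.^ j ℕ.∣ n ⇔ (+ q) ^ j ∣ˢ Y n
  q^j∣n⇔q^j∣Y j n = mk⇔ (q^j∣n⇒q^j∣Y j) (q^j∣Y⇒q^j∣n j n)

module _ (m : ℤ) where
  open PowersOfγ m (m * m + + 1)

  G[2m]≡Y : ∀ n → G (+ 2 * m) n ≡ Y n
  G[2m]≡Y zero          = refl
  G[2m]≡Y (suc zero)    = refl
  G[2m]≡Y (suc (suc n)) = begin
    + 2 * m * G (+ 2 * m) (suc n) + G (+ 2 * m) n
      ≡⟨ cong₂ (λ y′ y → + 2 * m * y′ + y) (G[2m]≡Y (suc n)) (G[2m]≡Y n) ⟩
    + 2 * m * Y (suc n) + Y n
      ≡⟨ unit m (Y (suc n)) (Y n) ⟩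
    + 2 * m * Y (suc n) + (m * m + + 1 - m * m) * Y n
      ≡⟨ Y-recurrence n ⟨
    Y (suc (suc n))
      ∎
    where
    open ≡-Reasoning
    unit : ∀ m y′ y → + 2 * m * y′ + y ≡ + 2 * m * y′ + (m * m + + 1 - m * m) * y
    unit = solve-∀

module _ (p : ℤ) where
  open PowersOfγ p (r p)

  2Y≡2ⁿG : ∀ n → + 2 * Y n ≡ (+ 2) ^ n * G p n
  2Y≡2ⁿG zero          = refl
  2Y≡2ⁿG (suc zero)    = refl
  2Y≡2ⁿG (suc (suc n)) = begin
    + 2 * Y (suc (suc n))
      ≡⟨ cong (+ 2 *_) (Y-recurrence n) ⟩
    + 2 * (+ 2 * p * Y (suc n) + (r p - p * p) * Y n)
      ≡⟨ regroup p (Y (suc n)) (Y n) ⟩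
    + 2 * p * (+ 2 * Y (suc n)) + + 4 * (+ 2 * Y n)
      ≡⟨ cong₂ (λ y′ y → + 2 * p * y′ + + 4 * y) (2Y≡2ⁿG (suc n)) (2Y≡2ⁿG n) ⟩
    + 2 * p * ((+ 2) ^ suc n * G p (suc n)) + + 4 * ((+ 2) ^ n * G p n)
      ≡⟨ factor p ((+ 2) ^ n) (G p (suc n)) (G p n) ⟩
    (+ 2) ^ suc (suc n) * G p (suc (suc n))
      ∎
    where
    open ≡-Reasoning
    regroup : ∀ p y′ y → + 2 * (+ 2 * p * y′ + (p * (p * + 1) + + 4 - p * p) * y)
                       ≡ + 2 * p * (+ 2 * y′) + + 4 * (+ 2 * y)
    regroup = solve-∀
    factor : ∀ p P g′ g → + 2 * p * (+ 2 * P * g′) + + 4 * (P * g) ≡ + 2 * (+ 2 * P) * (p * g′ + g)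
    factor = solve-∀

q^j∣n⇔q^j∣G[2m] : ∀ m {q} → Prime q → + q ∣ˢ m * m + + 1 → ∀ j n →
                  q ℕ.^ j ℕ.∣ n ⇔ (+ q) ^ j ∣ˢ G (+ 2 * m) n
q^j∣n⇔q^j∣G[2m] m {q} pq q∣m²+1 j n =
  subst (λ g → q ℕ.^ j ℕ.∣ n ⇔ (+ q) ^ j ∣ˢ g) (sym (G[2m]≡Y m n)) (q^j∣n⇔q^j∣Y j n)
  where
  q∤m : ¬ + q ∣ˢ m
  q∤m q∣m = prime∤1 pq (∣⇒∣ᵤ (ℤ.∣m+n∣m⇒∣n q∣m²+1 (ℤ.∣m⇒∣m*n m q∣m)))
  q≢3 : q ≢ 3
  q≢3 refl = 3∤x²+1 m q∣m²+1
  open LiftingTheExponent m (m * m + + 1) pq q∣m²+1 q∤m q≢3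

q^j∣n⇔q^j∣G[p] : ∀ p {q} → Prime q → + q ∣ˢ r p → q ≢ 2 → ∀ j n →
                 q ℕ.^ j ℕ.∣ n ⇔ (+ q) ^ j ∣ˢ G p n
q^j∣n⇔q^j∣G[p] p {q} pq q∣r q≢2 j n = ⇔.trans (q^j∣n⇔q^j∣Y j n) (mk⇔ toG fromG)
  where
  q∤2 : ¬ + q ∣ˢ + 2
  q∤2 = q≢2 ∘ prime∣prime⇒≡ pq prime[2] ∘ ∣⇒∣ᵤ
  q∤p : ¬ + q ∣ˢ p
  q∤p q∣p = q∤2 (prime∣^⇒∣-ℤ (+ 2) 2 pq (ℤ.∣m+n∣m⇒∣n q∣r (ℤ.∣m⇒∣m*n (p * + 1) q∣p)))
  q≢3 : q ≢ 3
  q≢3 refl = 3∤x²+1 p (ℤ.∣m+n∣n⇒∣m (subst (+ 3 ∣ˢ_) (shift p) q∣r) (divides (+ 1) refl))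
    where
    shift : ∀ p → p * (p * + 1) + + 4 ≡ p * p + + 1 + + 3
    shift = solve-∀
  open PowersOfγ p (r p) using (Y)
  open LiftingTheExponent p (r p) pq q∣r q∤p q≢3
  toG : (+ q) ^ j ∣ˢ Y n → (+ q) ^ j ∣ˢ G p n
  toG qʲ∣Y = prime^∣*⇒∣-ℤ ((+ 2) ^ n) (G p n) j pq (q∤2 ∘ prime∣^⇒∣-ℤ (+ 2) n pq)
    (subst ((+ q) ^ j ∣ˢ_) (2Y≡2ⁿG p n) (ℤ.∣n⇒∣m*n (+ 2) qʲ∣Y))
  fromG : (+ q) ^ j ∣ˢ G p n → (+ q) ^ j ∣ˢ Y n
  fromG qʲ∣G = prime^∣*⇒∣-ℤ (+ 2) (Y n) j pq q∤2
    (subst ((+ q) ^ j ∣ˢ_) (sym (2Y≡2ⁿG p n)) (ℤ.∣n⇒∣m*n ((+ 2) ^ n) qʲ∣G))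

2∤r[2m+1] : ∀ m → ¬ + 2 ∣ˢ r (+ 2 * m + + 1)
2∤r[2m+1] m 2∣r =
  prime∤1 prime[2] (∣⇒∣ᵤ (ℤ.∣m+n∣n⇒∣m {m = + 1} (subst (+ 2 ∣ˢ_) (split m) 2∣r) (divides l refl)))
  where
  l = + 2 * m * m + + 2 * m + + 2
  split : ∀ m → (+ 2 * m + + 1) * ((+ 2 * m + + 1) * + 1) + + 4 ≡ + 1 + (+ 2 * m * m + + 2 * m + + 2) * + 2
  split = solve-∀

r[2m]/4≡m²+1 : ∀ m → r (+ 2 * m) / + 4 ≡ m * m + + 1
r[2m]/4≡m²+1 m = trans (cong (_/ + 4) (split m)) (i*j/j≡i (m * m + + 1) (+ 4))
  where
  split : ∀ m → + 2 * m * (+ 2 * m * + 1) + + 4 ≡ (m * m + + 1) * + 4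
  split = solve-∀

q^j∣n⇔q^j∣G : ∀ {p s q} →
  (IntOdd p × (+ s ∣ r p)) ⊎ (IntEven p × (+ s ∣ (r p / + 4))) ⊎ (s ≥ 3 × Prime s × (+ s ∣ r p)) →
  Prime q → q ℕ.∣ s → ∀ j n → q ℕ.^ j ℕ.∣ n ⇔ (+ q) ^ j ∣ˢ G p n
q^j∣n⇔q^j∣G (inj₁ ((m , refl) , s∣r)) pq q∣s =
  q^j∣n⇔q^j∣G[p] _ pq q∣r (λ q≡2 → 2∤r[2m+1] m (subst (λ d → + d ∣ˢ _) q≡2 q∣r))
  where q∣r = ∣ᵤ⇒∣ (ℕ.∣-trans q∣s s∣r)
q^j∣n⇔q^j∣G {q = q} (inj₂ (inj₁ ((m , refl) , s∣r/4))) pq q∣s =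
  q^j∣n⇔q^j∣G[2m] m pq (∣ᵤ⇒∣ (subst (q ℕ.∣_) (cong ∣_∣ (r[2m]/4≡m²+1 m)) (ℕ.∣-trans q∣s s∣r/4)))
q^j∣n⇔q^j∣G {p} (inj₂ (inj₂ (s≥3 , ps , s∣r))) pq q∣s =
  q^j∣n⇔q^j∣G[p] p pq (∣ᵤ⇒∣ (ℕ.∣-trans q∣s s∣r)) λ q≡2 → 3≰2 (subst (3 ℕ.≤_) (trans (sym q≡s) q≡2) s≥3)
  where
  q≡s = prime∣prime⇒≡ pq ps q∣s
  3≰2 : ¬ 3 ℕ.≤ 2
  3≰2 (ℕ.s≤s (ℕ.s≤s ()))

corollary1p5 : (p : ℤ) (s : ℕ) → s ≥ 1 →
    ((IntOdd p × (+ s ∣ r p)) ⊎ (IntEven p × (+ s ∣ (r p / + 4))) ⊎ (s ≥ 3 × Prime s × (+ s ∣ r p))) →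
    (k n : ℕ) → ((+ s) ^ k ∣ + n) ⇔ ((+ s) ^ k ∣ G p n)
corollary1p5 p s s≥1 hyp k n =
  subst (λ d → d ℕ.∣ n ⇔ d ℕ.∣ ∣ G p n ∣) (sym (∣i^n∣≡∣i∣^n (+ s) k))
    (mk⇔ (^∣-transfer k λ j pq q∣s → Equivalence.to   (q^j∣n⇔q^j∣∣G∣ j pq q∣s))
         (^∣-transfer k λ j pq q∣s → Equivalence.from (q^j∣n⇔q^j∣∣G∣ j pq q∣s)))
  where
  instance _ = ℕ.>-nonZero s≥1
  q^j∣n⇔q^j∣∣G∣ : ∀ {q} j → Prime q → q ℕ.∣ s → q ℕ.^ j ℕ.∣ n ⇔ q ℕ.^ j ℕ.∣ ∣ G p n ∣
  q^j∣n⇔q^j∣∣G∣ {q} j pq q∣s = ⇔.trans (q^j∣n⇔q^j∣G hyp pq q∣s j n) (+q^j∣ˢi⇔q^j∣∣i∣ q j (G p n))
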